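{- If $T$ is a tournament with exactly $k$ strongly connected components, then $k/2\leq dib(T)$.
   Context: A tournament is a digraph obtained by orienting each edge of a complete graph (exactly one of $uv$, $vu$ is a dart for each pair of distinct vertices). A digraph is strongly connected if for every ordered pair of vertices $u,v$ there is a directed path from $u$ to $v$; strongly connected components are the maximal strongly connected induced subdigraphs. A coloring of a digraph with $k$ colors is a surjective map $\varsigma:V\to\{1,\dots,k\}$; it is acyclic if each color class induces a subdigraph with no directed cycle. With respect to $\varsigma$, a vertex $u$ is a $b^+$-vertex if for every color $j\neq\varsigma(u)$ there is a dart $uw$ with $\varsigma(w)=j$, and a $b^-$-vertex if for every color $j\neq \varsigma(u)$ there is a dart $wu$ with $\varsigma(w)=j$. A $b$-coloring is a coloring in which every color class contains a $b^+$-vertex and a $b^-$-vertex. The dib-chromatic number $dib(D)$ is the largest $k$ such that $D$ admits an acyclic $b$-coloring with $k$ colors. -}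

module Defs where

open import Level using (0ℓ)
open import Data.Nat using (ℕ)
open import Data.Fin using (Fin)
open import Data.Product using (Σ; _×_; ∃)
open import Data.Sum using (_⊎_)
open import Relation.Nullary using (¬_)
open import Relation.Binary.PropositionalEquality using (_≡_; _≢_)
open import Relation.Binary.Construct.Closure.ReflexiveTransitive using (Star)
open import Relation.Binary.Construct.Closure.Transitive using (TransClosure)

Digraph : ℕ → Set₁
Digraph n = Fin n → Fin n → Set

record IsTournament {n : ℕ} (D : Digraph n) : Set where
  field
    irrefl    : ∀ u → ¬ D u u
    total     : ∀ u v → u ≢ v → D u v ⊎ D v u
    antisym   : ∀ u v → D u v → ¬ D v u

Reaches : ∀ {n} → Digraph n → Fin n → Fin n → Set
Reaches D = Star D

SameSCC : ∀ {n} → Digraph n → Fin n → Fin n → Set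
SameSCC D u v = Reaches D u v × Reaches D v u

HasExactlySCCs : ∀ {n} → Digraph n → ℕ → Set
HasExactlySCCs {n} D k =
  Σ (Fin n → Fin k) λ c →
    (∀ i → ∃ λ u → c u ≡ i) ×
    (∀ u v → (c u ≡ c v → SameSCC D u v) × (SameSCC D u v → c u ≡ c v))

IsColoring : ∀ {n k} → (Fin n → Fin k) → Set
IsColoring {n} {k} ς = ∀ i → ∃ λ (u : Fin n) → ς u ≡ i

MonoDart : ∀ {n k} → Digraph n → (Fin n → Fin k) → Fin n → Fin n → Set
MonoDart D ς x y = D x y × ς x ≡ ς y

IsAcyclicColoring : ∀ {n k} → Digraph n → (Fin n → Fin k) → Set
IsAcyclicColoring D ς = ∀ u → ¬ TransClosure (MonoDart D ς) u u

IsBPlus : ∀ {n k} → Digraph n → (Fin n → Fin k) → Fin n → Set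
IsBPlus D ς u = ∀ j → j ≢ ς u → ∃ λ w → D u w × ς w ≡ j

IsBMinus : ∀ {n k} → Digraph n → (Fin n → Fin k) → Fin n → Set
IsBMinus D ς u = ∀ j → j ≢ ς u → ∃ λ w → D w u × ς w ≡ j

IsBColoring : ∀ {n k} → Digraph n → (Fin n → Fin k) → Set
IsBColoring D ς =
  IsColoring ς ×
  (∀ i → (∃ λ u → ς u ≡ i × IsBPlus D ς u) × (∃ λ u → ς u ≡ i × IsBMinus D ς u))

AdmitsAcyclicBColoring : ∀ {n} → Digraph n → ℕ → Set
AdmitsAcyclicBColoring {n} D k =
  Σ (Fin n → Fin k) λ ς → IsBColoring D ς × IsAcyclicColoring D ς

IsDib : ∀ {n} → Digraph n → ℕ → Set
IsDib D d = AdmitsAcyclicBColoring D d × (∀ k → AdmitsAcyclicBColoring D k → k Data.Nat.≤ d)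

-- Inside each strong component C the usual b-coloring reduction applies: start from the
-- discrete coloring and, while some class j has no b⁺-vertex (or no b⁻-vertex), move every
-- vertex of class j to a color missing from its out- (or in-)neighbourhood. Acyclicity is
-- preserved, so this ends in an acyclic b-coloring ψ_C of C. Monochromatic cycles never
-- leave a strong component, hence colorings of the components can be glued.
--
-- Rank the k + 1 components 0, …, k along the condensation, which is a transitive
-- tournament, and let h = ⌊k/2⌋, so that k + 1 ≤ 2(h + 1). If some ψ_C has at least h + 1
-- colors, use the largest one on every component: its b-vertices remain b-vertices of T.
-- Otherwise every ψ_C fits into h + 1 colors; permute each so that the representative of
-- the component of rank x gets color min(x, k − x). Color t then occurs in the components
-- of rank t and k − t, and as t < k − j whenever t ≠ j, the first is a b⁺-vertex and the
-- second a b⁻-vertex.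

{-# OPTIONS --safe #-}
module Submission where

open import Defs
open import Data.Nat using (ℕ; zero; suc; _≤_; _<_; _+_; _*_; _∸_; _⊓_; ⌊_/2⌋; ⌈_/2⌉; z≤n; s≤s; _≤?_)
open import Data.Nat.Properties
  using ( ≤-refl; ≤-trans; <⇒≤; ≰⇒>; 1+n≰n; n≤1+n; <-irrefl; <-asym; ≤∧≢⇒<; m≤n⇒m<n∨m≡n
        ; +-suc; +-identityʳ; +-mono-≤; +-monoˡ-≤; +-monoʳ-≤; *-monoʳ-≤; m≤m+n
        ; m∸n≤m; m≤n+o⇒m∸n≤o; m+n≤o⇒m≤o∸n; m∸[m∸n]≡n; m⊓n≤m; m⊓n≤n; ⊓-comm; m≤n⇒m⊓n≡m
        ; ⌊n/2⌋≤⌈n/2⌉; ⌊n/2⌋+⌈n/2⌉≡n; ⌊n/2⌋-mono; module ≤-Reasoning )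
open import Data.Fin using (Fin; zero; suc; punchIn; punchOut; _≟_; fromℕ<; toℕ; inject≤)
open import Data.Fin.Properties
  using ( ¬Fin0; any?; all?; ¬∀⟶∃¬; punchInᵢ≢i; punchOut-injective; injective⇒≤; fromℕ<-injective
        ; toℕ-injective; toℕ-fromℕ<; toℕ≤pred[n]; inject≤-injective; inject≤-refl )
import Data.Fin.Permutation.Components as PC
open import Data.Fin.Subset using (Subset; _∈_; inside; ∣_∣)
open import Data.Fin.Subset.Properties using (p⊂q⇒∣p∣<∣q∣; ⊆⊤; ∈⊤; ∣⊤∣≡n)
open import Data.Vec using (tabulate)
open import Data.Vec.Properties using (lookup∘tabulate; []=⇒lookup; lookup⇒[]=)
open import Data.Product using (Σ; ∃; _×_; _,_; proj₁; proj₂)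
open import Data.Empty using (⊥-elim)
open import Data.Sum using (_⊎_; inj₁; inj₂)
open import Function using (_∘_; flip; id)
open import Function.Definitions using (Injective)
open import Relation.Nullary using (¬_; Dec; yes; no; does)
open import Relation.Nullary.Decidable using (_×-dec_; _→-dec_; ¬?; decidable-stable; dec-true)
open import Relation.Binary.Definitions using (Decidable)
import Relation.Unary as U
open import Relation.Binary.PropositionalEquality
  using (_≡_; _≢_; refl; sym; trans; cong; subst; subst₂; module ≡-Reasoning)
open import Relation.Binary.Construct.Closure.Transitive using (TransClosure; [_]; _∷_; _∷ʳ_)
open import Relation.Binary.Construct.Closure.ReflexiveTransitive using (Star; ε; _◅_; _◅◅_)

module _ {A : Set} {R R′ : A → A → Set} where

  map⁺ : (∀ {x y} → R x y → R′ x y) → ∀ {x y} → TransClosure R x y → TransClosure R′ x y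
  map⁺ f [ r ]    = [ f r ]
  map⁺ f (r ∷ rs) = f r ∷ map⁺ f rs

  reverse⁺ : (∀ {x y} → R x y → R′ y x) → ∀ {x y} → TransClosure R x y → TransClosure R′ y x
  reverse⁺ f [ r ]    = [ f r ]
  reverse⁺ f (r ∷ rs) = reverse⁺ f rs ∷ʳ f r

  ⁺⇒⋆ : (∀ {x y} → R x y → R′ x y) → ∀ {x y} → TransClosure R x y → Star R′ x y
  ⁺⇒⋆ f [ r ]    = f r ◅ ε
  ⁺⇒⋆ f (r ∷ rs) = f r ◅ ⁺⇒⋆ f rs

  -- A predicate that is closed forward along R is constant on every R-cycle.
  lift-cycle : {P : A → Set} → U.Decidable P →
               (∀ {x y} → R x y → P x → P y) →
               (∀ {x y} → R x y → P x → R′ x y) →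
               (∀ {x y} → R x y → ¬ P y → R′ x y) →
               ∀ {x} → TransClosure R x x → TransClosure R′ x x
  lift-cycle {P} P? forward on-P off-P {x} cycle with P? x
  ... | yes p = forward⁺ cycle p
    where
    forward⁺ : ∀ {x y} → TransClosure R x y → P x → TransClosure R′ x y
    forward⁺ [ r ]    p = [ on-P r p ]
    forward⁺ (r ∷ rs) p = on-P r p ∷ forward⁺ rs (forward r p)
  ... | no ¬p = proj₂ (backward⁺ cycle ¬p)
    where
    backward⁺ : ∀ {x y} → TransClosure R x y → ¬ P y → ¬ P x × TransClosure R′ x y
    backward⁺ [ r ]    ¬p = ¬p ∘ forward r , [ off-P r ¬p ]
    backward⁺ (r ∷ rs) ¬p with backward⁺ rs ¬p
    ... | ¬q , rs′ = ¬q ∘ forward r , off-P r ¬q ∷ rs′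

_↾_ : ∀ {n} → Digraph n → (Fin n → Set) → Digraph n
(D ↾ S) u v = D u v × S u × S v

module _ {n : ℕ} {D : Digraph n} where

  acyclic-reindex : ∀ {a b} {D′ : Digraph n} {ψ : Fin n → Fin a} {χ : Fin n → Fin b} →
                    (∀ {x y} → MonoDart D′ χ x y → MonoDart D ψ x y) →
                    IsAcyclicColoring D ψ → IsAcyclicColoring D′ χ
  acyclic-reindex f acyclic u = acyclic u ∘ map⁺ f

  acyclic-flip : ∀ {a} {ψ : Fin n → Fin a} → IsAcyclicColoring D ψ → IsAcyclicColoring (flip D) ψ
  acyclic-flip acyclic u = acyclic u ∘ reverse⁺ λ (d , e) → d , sym e

  acyclic-∘ : ∀ {a b} {ψ : Fin n → Fin a} {f : Fin a → Fin b} → Injective _≡_ _≡_ f →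
              IsAcyclicColoring D ψ → IsAcyclicColoring D (f ∘ ψ)
  acyclic-∘ f-injective = acyclic-reindex λ (d , e) → d , f-injective e

  acyclic-discrete : (∀ u → ¬ D u u) → IsAcyclicColoring D id
  acyclic-discrete irrefl u [ d , refl ]     = irrefl u d
  acyclic-discrete irrefl u ((d , refl) ∷ _) = irrefl u d

module _ {n a : ℕ} {E : Digraph n} (E? : Decidable E) (ψ : Fin n → Fin a) where

  private
    offers? : ∀ u t → Dec (t ≢ ψ u → ∃ λ w → E u w × ψ w ≡ t)
    offers? u t = ¬? (t ≟ ψ u) →-dec any? λ w → E? u w ×-dec ψ w ≟ t

  IsBPlus? : ∀ u → Dec (IsBPlus E ψ u)
  IsBPlus? u = all? (offers? u)

  missing-color : ∀ {u} → ¬ IsBPlus E ψ u → ∃ λ t → t ≢ ψ u × ∀ {w} → E u w → ψ w ≢ t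
  missing-color {u} ¬b⁺ with ¬∀⟶∃¬ a _ (offers? u) ¬b⁺
  ... | t , ¬offers = t , (λ t≡ψu → ¬offers λ t≢ψu → ⊥-elim (t≢ψu t≡ψu)) , λ d e → ¬offers λ _ → _ , d , e

HasBPlusIn : ∀ {n a} → (Fin n → Set) → Digraph n → (Fin n → Fin a) → Fin a → Set
HasBPlusIn S E ψ t = ∃ λ u → S u × ψ u ≡ t × IsBPlus E ψ u

-- IsBMinus E ψ is definitionally IsBPlus (flip E) ψ.
HasBVerticesIn : ∀ {n a} → (Fin n → Set) → Digraph n → (Fin n → Fin a) → Fin a → Set
HasBVerticesIn S E ψ t = HasBPlusIn S E ψ t × HasBPlusIn S (flip E) ψ t

IsBColoringOn : ∀ {n a} → (Fin n → Set) → Digraph n → (Fin n → Fin a) → Set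
IsBColoringOn S E ψ = ∀ t → HasBVerticesIn S E ψ t

record AcyclicBColoringOn {n} (S : Fin n → Set) (E : Digraph n) : Set where
  field
    colors     : ℕ
    coloring   : Fin n → Fin colors
    acyclic    : IsAcyclicColoring E coloring
    b-coloring : IsBColoringOn S E coloring

module _ {n a : ℕ} {S : Fin n → Set} (S? : U.Decidable S) where

  HasBPlusIn? : ∀ {E : Digraph n} → Decidable E → (ψ : Fin n → Fin a) → ∀ t → Dec (HasBPlusIn S E ψ t)
  HasBPlusIn? E? ψ t = any? λ u → S? u ×-dec ψ u ≟ t ×-dec IsBPlus? E? ψ u

  HasBVerticesIn? : ∀ {E : Digraph n} → Decidable E → (ψ : Fin n → Fin a) → ∀ t → Dec (HasBVerticesIn S E ψ t)
  HasBVerticesIn? E? ψ t = HasBPlusIn? E? ψ t ×-dec HasBPlusIn? (flip E?) ψ t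

  IsBColoringOn? : ∀ {E : Digraph n} → Decidable E → (ψ : Fin n → Fin a) → Dec (IsBColoringOn S E ψ)
  IsBColoringOn? E? ψ = all? (HasBVerticesIn? E? ψ)

-- With at least two colors a b⁺-vertex has an out-dart, so it lies in S.
¬HasBPlusIn⇒¬IsBPlus : ∀ {n L} {S : Fin n → Set} {E : Digraph n} {ψ : Fin n → Fin (suc (suc L))} {j} →
                       (∀ {u w} → E u w → S u) → ¬ HasBPlusIn S E ψ j →
                       ∀ {u} → ψ u ≡ j → ¬ IsBPlus E ψ u
¬HasBPlusIn⇒¬IsBPlus {ψ = ψ} E⇒S ¬b⁺ {u} ψu≡j b⁺ with b⁺ (punchIn (ψ u) zero) (punchInᵢ≢i (ψ u) zero)
... | _ , d , _ = ¬b⁺ (u , E⇒S d , ψu≡j , b⁺)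

module RemoveColor {n L : ℕ} {E : Digraph n} (E? : Decidable E)
                    (ψ : Fin n → Fin (suc (suc L))) (j : Fin (suc (suc L)))
                    (¬b⁺ : ∀ {u} → ψ u ≡ j → ¬ IsBPlus E ψ u) where

  record Recoloring (u : Fin n) : Set where
    field
      color   : Fin (suc (suc L))
      ≢j      : color ≢ j
      missing : ψ u ≡ j → ∀ {w} → E u w → ψ w ≢ color
      kept    : ψ u ≢ j → color ≡ ψ u

  recoloring : ∀ u → Recoloring u
  recoloring u with ψ u ≟ j
  ... | yes ψu≡j = let t , t≢ψu , missing = missing-color E? ψ (¬b⁺ ψu≡j) in record
    { color = t ; ≢j = λ t≡j → t≢ψu (trans t≡j (sym ψu≡j))
    ; missing = λ _ → missing ; kept = λ ψu≢j → ⊥-elim (ψu≢j ψu≡j) }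
  ... | no ψu≢j = record
    { color = ψ u ; ≢j = ψu≢j
    ; missing = λ ψu≡j → ⊥-elim (ψu≢j ψu≡j) ; kept = λ _ → refl }

  open Recoloring

  recolor : Fin n → Fin (suc (suc L))
  recolor u = color (recoloring u)

  ψ′ : Fin n → Fin (suc L)
  ψ′ u = punchOut (≢j (recoloring u) ∘ sym)

  -- Color j is closed forward along new monochromatic darts, so a new monochromatic
  -- cycle lies entirely inside or entirely outside the old class j.
  acyclic : IsAcyclicColoring E ψ → IsAcyclicColoring E ψ′
  acyclic ψ-acyclic u = ψ-acyclic u ∘ lift-cycle (λ v → ψ v ≟ j) forward inside-j outside-j ∘ map⁺ unpunch
    where
    unpunch : ∀ {x y} → MonoDart E ψ′ x y → MonoDart E recolor x y
    unpunch {x} {y} (d , e) = d , punchOut-injective (≢j (recoloring x) ∘ sym) (≢j (recoloring y) ∘ sym) e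

    forward : ∀ {x y} → MonoDart E recolor x y → ψ x ≡ j → ψ y ≡ j
    forward {x} {y} (d , e) ψx≡j = decidable-stable (ψ y ≟ j) λ ψy≢j →
      missing (recoloring x) ψx≡j d (sym (trans e (kept (recoloring y) ψy≢j)))

    inside-j : ∀ {x y} → MonoDart E recolor x y → ψ x ≡ j → MonoDart E ψ x y
    inside-j m@(d , _) ψx≡j = d , trans ψx≡j (sym (forward m ψx≡j))

    outside-j : ∀ {x y} → MonoDart E recolor x y → ψ y ≢ j → MonoDart E ψ x y
    outside-j {x} {y} m@(d , e) ψy≢j = d , (begin
      ψ x        ≡⟨ kept (recoloring x) (ψy≢j ∘ forward m) ⟨
      recolor x  ≡⟨ e ⟩
      recolor y  ≡⟨ kept (recoloring y) ψy≢j ⟩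
      ψ y        ∎)
      where open ≡-Reasoning

module _ {n : ℕ} {S : Fin n → Set} (S? : U.Decidable S) {E : Digraph n} (E? : Decidable E)
         (E-within : ∀ {u w} → E u w → S u × S w) where

  b-coloring-or-drop-color : ∀ {L} (ψ : Fin n → Fin (suc (suc L))) → IsAcyclicColoring E ψ →
                             IsBColoringOn S E ψ ⊎ Σ (Fin n → Fin (suc L)) (IsAcyclicColoring E)
  b-coloring-or-drop-color ψ ψ-acyclic with IsBColoringOn? S? E? ψ
  ... | yes b = inj₁ b
  ... | no ¬b with j , ¬b⁺⁻ ← ¬∀⟶∃¬ _ _ (HasBVerticesIn? S? E? ψ) ¬b
              with HasBPlusIn? S? E? ψ j
  ...   | no ¬b⁺ = inj₂ (ψ′ , acyclic ψ-acyclic)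
    where open RemoveColor E? ψ j (¬HasBPlusIn⇒¬IsBPlus (proj₁ ∘ E-within) ¬b⁺)
  ...   | yes b⁺ = inj₂ (ψ′ , acyclic-flip (acyclic (acyclic-flip ψ-acyclic)))
    where open RemoveColor (flip E?) ψ j (¬HasBPlusIn⇒¬IsBPlus (proj₂ ∘ E-within) (¬b⁺⁻ ∘ (b⁺ ,_)))

  module _ {u₀} (u₀∈S : S u₀) where

    reduce≥1 : ∀ L (ψ : Fin n → Fin (suc L)) → IsAcyclicColoring E ψ → AcyclicBColoringOn S E
    reduce≥1 zero ψ ψ-acyclic = record
      { colors = 1 ; coloring = ψ ; acyclic = ψ-acyclic
      ; b-coloring = λ t → (u₀ , u₀∈S , single , vacuous) , (u₀ , u₀∈S , single , vacuous) }
      where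
      single : ∀ {s t : Fin 1} → s ≡ t
      single {zero} {zero} = refl
      vacuous : ∀ {B : Fin 1 → Set} j → j ≢ ψ u₀ → B j
      vacuous j j≢ψu₀ = ⊥-elim (j≢ψu₀ single)
    reduce≥1 (suc L) ψ ψ-acyclic with b-coloring-or-drop-color ψ ψ-acyclic
    ... | inj₁ b = record { colors = suc (suc L) ; coloring = ψ ; acyclic = ψ-acyclic ; b-coloring = b }
    ... | inj₂ (ψ′ , ψ′-acyclic) = reduce≥1 L ψ′ ψ′-acyclic

    reduce : ∀ {a} (ψ : Fin n → Fin a) → IsAcyclicColoring E ψ → AcyclicBColoringOn S E
    reduce {zero}  ψ _ = ⊥-elim (¬Fin0 (ψ u₀))
    reduce {suc L} ψ   = reduce≥1 L ψ

  acyclic-b-coloring-on : (∀ u → ¬ E u u) → ∀ {u₀} → S u₀ → AcyclicBColoringOn S E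
  acyclic-b-coloring-on irrefl u₀∈S = reduce u₀∈S id (acyclic-discrete irrefl)

b⁺-transfer : ∀ {n a} {S : Fin n → Set} {E D : Digraph n} {ψ χ : Fin n → Fin a} →
              (∀ {u w} → E u w → D u w × S w) → (∀ {w} → S w → χ w ≡ ψ w) →
              ∀ {u} → S u → IsBPlus E ψ u → IsBPlus D χ u
b⁺-transfer E⇒D χ≗ψ u∈S b⁺ j j≢χu with w , e , ψw≡j ← b⁺ j (λ j≡ψu → j≢χu (trans j≡ψu (sym (χ≗ψ u∈S))))
  = w , proj₁ (E⇒D e) , trans (χ≗ψ (proj₂ (E⇒D e))) ψw≡j

Fibre : ∀ {n K} → (Fin n → Fin K) → Fin K → Fin n → Set
Fibre c i u = c u ≡ i

glue-acyclic : ∀ {n K N} {D : Digraph n} {c : Fin n → Fin K} →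
               (∀ {u v} → Reaches D u v → Reaches D v u → c u ≡ c v) →
               (F : Fin K → Fin n → Fin N) → (∀ i → IsAcyclicColoring (D ↾ Fibre c i) (F i)) →
               IsAcyclicColoring D (λ u → F (c u) u)
glue-acyclic {D = D} {c} mutual⇒same F F-acyclic u cycle = F-acyclic (c u) u (localise refl cycle ε)
  where
  χ : _ → _
  χ u = F (c u) u

  χ-at : ∀ {i x} → c x ≡ i → χ x ≡ F i x
  χ-at refl = refl

  localise-dart : ∀ {i x y} → c x ≡ i → MonoDart D χ x y → Reaches D y x →
                  c y ≡ i × MonoDart (D ↾ Fibre c i) (F i) x y
  localise-dart cx≡i (d , e) back = cy≡i , (d , cx≡i , cy≡i) , trans (sym (χ-at cx≡i)) (trans e (χ-at cy≡i))
    where cy≡i = trans (sym (mutual⇒same (d ◅ ε) back)) cx≡i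

  localise : ∀ {i x y} → c x ≡ i → TransClosure (MonoDart D χ) x y → Reaches D y x →
             TransClosure (MonoDart (D ↾ Fibre c i) (F i)) x y
  localise cx≡i [ m ] back = [ proj₂ (localise-dart cx≡i m back) ]
  localise cx≡i (m ∷ ms) back with cz≡i , m′ ← localise-dart cx≡i m (⁺⇒⋆ proj₁ ms ◅◅ back)
    = m′ ∷ localise cz≡i ms (back ◅◅ (proj₁ m ◅ ε))

module _ {m : ℕ} {P : Fin m → Set} (P? : U.Decidable P) where

  subset : Subset m
  subset = tabulate (does ∘ P?)

  ∈-subset⁺ : ∀ {x} → P x → x ∈ subset
  ∈-subset⁺ {x} p = lookup⇒[]= x _ (trans (lookup∘tabulate _ x) (dec-true (P? x) p))

  ∈-subset⁻ : ∀ {x} → x ∈ subset → P x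
  ∈-subset⁻ {x} x∈ = does⇒ {a? = P? x} (trans (sym (lookup∘tabulate _ x)) ([]=⇒lookup x∈))
    where
    does⇒ : ∀ {A : Set} {a? : Dec A} → does a? ≡ inside → A
    does⇒ {a? = yes a} _ = a

injective⇒surjective : ∀ {m} {f : Fin m → Fin m} → Injective _≡_ _≡_ f → ∀ y → ∃ λ x → f x ≡ y
injective⇒surjective {suc m} {f} f-injective y with any? (λ x → f x ≟ y)
... | yes hit = hit
... | no miss = ⊥-elim (1+n≰n (injective⇒≤ {f = skip} (f-injective ∘ punchOut-injective (avoid _) (avoid _))))
  where
  avoid : ∀ x → y ≢ f x
  avoid x y≡fx = miss (x , sym y≡fx)
  skip : Fin (suc m) → Fin m
  skip x = punchOut (avoid x)

argmax : ∀ {m} (f : Fin (suc m) → ℕ) → ∃ λ i₀ → ∀ i → f i ≤ f i₀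
argmax {zero} f = zero , λ { zero → ≤-refl }
argmax {suc m} f with i₀ , max ← argmax (f ∘ suc) | f zero ≤? f (suc i₀)
... | yes f0≤ = suc i₀ , λ { zero → f0≤ ; (suc i) → max i }
... | no f0≰ = zero , λ { zero → ≤-refl ; (suc i) → ≤-trans (max i) (<⇒≤ (≰⇒> f0≰)) }

transpose-injective : ∀ {m} (i j : Fin m) → Injective _≡_ _≡_ (PC.transpose i j)
transpose-injective i j {x} {y} e =
  trans (sym (PC.transpose-inverse j i)) (trans (cong (PC.transpose j i) e) (PC.transpose-inverse j i))

transpose-sends : ∀ {m} (i j : Fin m) → PC.transpose i j i ≡ j
transpose-sends i j rewrite dec-true (i ≟ i) refl = refl

module Folding (k : ℕ) where

  h : ℕ
  h = ⌊ k /2⌋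

  h+h≤k : h + h ≤ k
  h+h≤k = begin
    h + h          ≤⟨ +-monoʳ-≤ h (⌊n/2⌋≤⌈n/2⌉ k) ⟩
    h + ⌈ k /2⌉    ≡⟨ ⌊n/2⌋+⌈n/2⌉≡n k ⟩
    k              ∎
    where open ≤-Reasoning

  k≤1+h+h : k ≤ suc (h + h)
  k≤1+h+h = begin
    k              ≡⟨ ⌊n/2⌋+⌈n/2⌉≡n k ⟨
    h + ⌈ k /2⌉    ≤⟨ +-monoʳ-≤ h (⌊n/2⌋-mono (n≤1+n (suc k))) ⟩
    h + suc h      ≡⟨ +-suc h h ⟩
    suc (h + h)    ∎
    where open ≤-Reasoning

  1+k≤2[1+h] : suc k ≤ 2 * suc h
  1+k≤2[1+h] = begin
    suc k              ≤⟨ s≤s k≤1+h+h ⟩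
    suc (suc (h + h))  ≡⟨ cong suc (+-suc h h) ⟨
    suc (h + suc h)    ≡⟨ cong (λ m → suc (h + m)) (+-identityʳ (suc h)) ⟨
    2 * suc h          ∎
    where open ≤-Reasoning

  h≤k : h ≤ k
  h≤k = ≤-trans (m≤m+n h h) h+h≤k

  fold : ℕ → ℕ
  fold x = x ⊓ (k ∸ x)

  fold≤h : ∀ x → fold x ≤ h
  fold≤h x with x ≤? h
  ... | yes x≤h = ≤-trans (m⊓n≤m x _) x≤h
  ... | no x≰h = ≤-trans (m⊓n≤n x _) (m≤n+o⇒m∸n≤o k x (≤-trans k≤1+h+h (+-monoˡ-≤ h (≰⇒> x≰h))))

  fold-low : ∀ {t} → t ≤ h → fold t ≡ t
  fold-low {t} t≤h = m≤n⇒m⊓n≡m (m+n≤o⇒m≤o∸n t (≤-trans (+-mono-≤ t≤h t≤h) h+h≤k))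

  fold-reflect : ∀ {x} → x ≤ k → fold (k ∸ x) ≡ fold x
  fold-reflect {x} x≤k = trans (cong ((k ∸ x) ⊓_) (m∸[m∸n]≡n x≤k)) (⊓-comm (k ∸ x) x)

  low<high : ∀ {t j} → t ≤ h → j ≤ h → t ≢ j → t < k ∸ j
  low<high {t} {j} t≤h j≤h t≢j = m+n≤o⇒m≤o∸n (suc t) (≤-trans below h+h≤k)
    where
    below : suc t + j ≤ h + h
    below with m≤n⇒m<n∨m≡n t≤h
    ... | inj₁ t<h  = +-mono-≤ t<h j≤h
    ... | inj₂ refl = begin
      suc t + j  ≡⟨ +-suc t j ⟨
      t + suc j  ≤⟨ +-monoʳ-≤ t (≤∧≢⇒< j≤h (t≢j ∘ sym)) ⟩
      t + t      ∎
      where open ≤-Reasoning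

module Condensation {n K : ℕ} {T : Digraph n} (tournament : IsTournament T) (sccs : HasExactlySCCs T K) where

  open IsTournament tournament

  c : Fin n → Fin K
  c = proj₁ sccs

  SCC : Fin K → Fin n → Set
  SCC = Fibre c

  T? : Decidable T
  T? u v with u ≟ v
  ... | yes refl = no (irrefl u)
  ... | no u≢v with total u v u≢v
  ...   | inj₁ d = yes d
  ...   | inj₂ d = no (antisym v u d)

  mutual⇒same-label : ∀ {u v} → Reaches T u v → Reaches T v u → c u ≡ c v
  mutual⇒same-label there back = proj₂ (proj₂ (proj₂ sccs) _ _) (there , back)

  rep : Fin K → Fin n
  rep i = proj₁ (proj₁ (proj₂ sccs) i)

  rep∈ : ∀ i → SCC i (rep i)
  rep∈ i = proj₂ (proj₁ (proj₂ sccs) i)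

  rep-mutual⇒≡ : ∀ {i j} → Reaches T (rep i) (rep j) → Reaches T (rep j) (rep i) → i ≡ j
  rep-mutual⇒≡ {i} {j} there back = trans (sym (rep∈ i)) (trans (mutual⇒same-label there back) (rep∈ j))

  _≺_ : Fin K → Fin K → Set
  i ≺ j = T (rep i) (rep j)

  _≺?_ : Decidable _≺_
  i ≺? j = T? (rep i) (rep j)

  ≺-irrefl : ∀ i → ¬ i ≺ i
  ≺-irrefl i = irrefl (rep i)

  ≺⇒≢ : ∀ {i j} → i ≺ j → i ≢ j
  ≺⇒≢ {i} i≺i refl = ≺-irrefl i i≺i

  ≺-total : ∀ {i j} → i ≢ j → i ≺ j ⊎ j ≺ i
  ≺-total {i} {j} i≢j = total (rep i) (rep j) λ e → i≢j (trans (sym (rep∈ i)) (trans (cong c e) (rep∈ j)))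

  ≺-trans : ∀ {i j l} → i ≺ j → j ≺ l → i ≺ l
  ≺-trans {i} {j} {l} i≺j j≺l with i ≟ l
  ... | yes refl = ⊥-elim (antisym _ _ i≺j j≺l)
  ... | no i≢l with ≺-total i≢l
  ...   | inj₁ i≺l = i≺l
  ...   | inj₂ l≺i = ⊥-elim (≺⇒≢ i≺j (rep-mutual⇒≡ (i≺j ◅ ε) (j≺l ◅ l≺i ◅ ε)))

  rank : Fin K → ℕ
  rank i = ∣ subset (_≺? i) ∣

  rank<K : ∀ i → rank i < K
  rank<K i = subst (rank i <_) (∣⊤∣≡n K) (p⊂q⇒∣p∣<∣q∣ (⊆⊤ , i , ∈⊤ , ≺-irrefl i ∘ ∈-subset⁻ (_≺? i)))

  rank-mono : ∀ {i j} → i ≺ j → rank i < rank j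
  rank-mono {i} {j} i≺j = p⊂q⇒∣p∣<∣q∣
    ( ∈-subset⁺ (_≺? j) ∘ (λ l≺i → ≺-trans l≺i i≺j) ∘ ∈-subset⁻ (_≺? i)
    , i , ∈-subset⁺ (_≺? j) i≺j , ≺-irrefl i ∘ ∈-subset⁻ (_≺? i))

  rank-injective : ∀ {i j} → rank i ≡ rank j → i ≡ j
  rank-injective {i} {j} same-rank with i ≟ j
  ... | yes i≡j = i≡j
  ... | no i≢j with ≺-total i≢j
  ...   | inj₁ i≺j = ⊥-elim (<-irrefl same-rank (rank-mono i≺j))
  ...   | inj₂ j≺i = ⊥-elim (<-irrefl (sym same-rank) (rank-mono j≺i))

  rank-surjective : ∀ {x} → x < K → ∃ λ i → rank i ≡ x
  rank-surjective {x} x<K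
    with i , e ← injective⇒surjective {f = λ i → fromℕ< (rank<K i)}
                   (rank-injective ∘ fromℕ<-injective _ _ (rank<K _) (rank<K _)) (fromℕ< x<K)
    = i , fromℕ<-injective _ _ (rank<K i) x<K e

  rank-≺ : ∀ {i j} → rank i < rank j → i ≺ j
  rank-≺ {i} {j} rank-i<j with i ≟ j
  ... | yes refl = ⊥-elim (<-irrefl refl rank-i<j)
  ... | no i≢j with ≺-total i≢j
  ...   | inj₁ i≺j = i≺j
  ...   | inj₂ j≺i = ⊥-elim (<-asym rank-i<j (rank-mono j≺i))

module _ {n k : ℕ} {T : Digraph n} (tournament : IsTournament T) (sccs : HasExactlySCCs T (suc k)) where

  open Condensation tournament sccs
  open AcyclicBColoringOn

  local : ∀ i → AcyclicBColoringOn (SCC i) (T ↾ SCC i)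
  local i = acyclic-b-coloring-on (λ u → c u ≟ i) (λ u v → T? u v ×-dec c u ≟ i ×-dec c v ≟ i) proj₂
                                  (λ u (d , _) → IsTournament.irrefl tournament u d) (rep∈ i)

  a : Fin (suc k) → ℕ
  a i = colors (local i)

  ψ : ∀ i → Fin n → Fin (a i)
  ψ i = coloring (local i)

  module Glued {N : ℕ} (g : ∀ i → Fin (a i) → Fin N) (g-injective : ∀ i → Injective _≡_ _≡_ (g i)) where

    χ : Fin n → Fin N
    χ u = g (c u) (ψ (c u) u)

    χ-at : ∀ {i u} → SCC i u → χ u ≡ g i (ψ i u)
    χ-at refl = refl

    χ-acyclic : IsAcyclicColoring T χ
    χ-acyclic = glue-acyclic mutual⇒same-label (λ i → g i ∘ ψ i)
                             (λ i → acyclic-∘ (g-injective i) (acyclic (local i)))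

  module Largest (i₀ : Fin (suc k)) (largest : ∀ i → a i ≤ a i₀) where

    open Glued (λ i x → inject≤ x (largest i)) (λ i → inject≤-injective _ _ _ _)

    χ≗ψ : ∀ {w} → SCC i₀ w → χ w ≡ ψ i₀ w
    χ≗ψ w∈ = trans (χ-at w∈) (inject≤-refl _ _)

    b⁺ : ∀ t → ∃ λ u → χ u ≡ t × IsBPlus T χ u
    b⁺ t with u , u∈ , ψu≡t , u-b⁺ ← proj₁ (b-coloring (local i₀) t)
      = u , trans (χ≗ψ u∈) ψu≡t , b⁺-transfer {E = T ↾ SCC i₀} {D = T} (λ (d , _ , w∈) → d , w∈) χ≗ψ u∈ u-b⁺

    b⁻ : ∀ t → ∃ λ u → χ u ≡ t × IsBMinus T χ u
    b⁻ t with u , u∈ , ψu≡t , u-b⁻ ← proj₂ (b-coloring (local i₀) t)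
      = u , trans (χ≗ψ u∈) ψu≡t , b⁺-transfer {E = flip (T ↾ SCC i₀)} {D = flip T} (λ (d , w∈ , _) → d , w∈) χ≗ψ u∈ u-b⁻

    admits : AdmitsAcyclicBColoring T (a i₀)
    admits = χ , ((λ t → proj₁ (b⁺ t) , proj₁ (proj₂ (b⁺ t))) , λ t → b⁺ t , b⁻ t) , χ-acyclic

  open Folding k

  module Folded (small : ∀ i → a i ≤ suc h) where

    slot : Fin (suc k) → Fin (suc h)
    slot i = fromℕ< (s≤s (fold≤h (rank i)))

    widen : ∀ i → Fin (a i) → Fin (suc h)
    widen i x = inject≤ x (small i)

    open Glued (λ i → PC.transpose (widen i (ψ i (rep i))) (slot i) ∘ widen i)
               (λ i → inject≤-injective _ _ _ _ ∘ transpose-injective _ _)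

    χ-rep : ∀ i → χ (rep i) ≡ slot i
    χ-rep i = trans (χ-at (rep∈ i)) (transpose-sends (widen i (ψ i (rep i))) (slot i))

    component : ∀ x → x ≤ k → Fin (suc k)
    component x x≤k = proj₁ (rank-surjective (s≤s x≤k))

    rank-component : ∀ x x≤k → rank (component x x≤k) ≡ x
    rank-component x x≤k = proj₂ (rank-surjective (s≤s x≤k))

    toℕ-χ-component : ∀ x x≤k → toℕ (χ (rep (component x x≤k))) ≡ fold x
    toℕ-χ-component x x≤k = begin
      toℕ (χ (rep (component x x≤k)))  ≡⟨ cong toℕ (χ-rep (component x x≤k)) ⟩
      toℕ (slot (component x x≤k))     ≡⟨ toℕ-fromℕ< _ ⟩
      fold (rank (component x x≤k))    ≡⟨ cong fold (rank-component x x≤k) ⟩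
      fold x                           ∎
      where open ≡-Reasoning

    component-dart : ∀ {x y} x≤k y≤k → x < y → T (rep (component x x≤k)) (rep (component y y≤k))
    component-dart {x} {y} x≤k y≤k x<y =
      rank-≺ (subst₂ _<_ (sym (rank-component x x≤k)) (sym (rank-component y y≤k)) x<y)

    toℕ≤k : ∀ (t : Fin (suc h)) → toℕ t ≤ k
    toℕ≤k t = ≤-trans (toℕ≤pred[n] t) h≤k

    low high : Fin (suc h) → Fin n
    low t  = rep (component (toℕ t) (toℕ≤k t))
    high t = rep (component (k ∸ toℕ t) (m∸n≤m k (toℕ t)))

    χ-low : ∀ t → χ (low t) ≡ t
    χ-low t = toℕ-injective (trans (toℕ-χ-component _ (toℕ≤k t)) (fold-low (toℕ≤pred[n] t)))

    χ-high : ∀ t → χ (high t) ≡ t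
    χ-high t = toℕ-injective (begin
      toℕ (χ (high t))   ≡⟨ toℕ-χ-component _ (m∸n≤m k (toℕ t)) ⟩
      fold (k ∸ toℕ t)   ≡⟨ fold-reflect (toℕ≤k t) ⟩
      fold (toℕ t)       ≡⟨ fold-low (toℕ≤pred[n] t) ⟩
      toℕ t              ∎)
      where open ≡-Reasoning

    low→high : ∀ {t j} → t ≢ j → T (low t) (high j)
    low→high {t} {j} t≢j = component-dart (toℕ≤k t) (m∸n≤m k (toℕ j))
      (low<high (toℕ≤pred[n] t) (toℕ≤pred[n] j) (t≢j ∘ toℕ-injective))

    admits : AdmitsAcyclicBColoring T (suc h)
    admits = χ , ((λ t → low t , χ-low t) , λ t → b⁺ t , b⁻ t) , χ-acyclic
      where
      b⁺ : ∀ t → ∃ λ u → χ u ≡ t × IsBPlus T χ u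
      b⁺ t = low t , χ-low t , λ j j≢t → high j , low→high (λ t≡j → j≢t (sym (trans (χ-low t) t≡j))) , χ-high j

      b⁻ : ∀ t → ∃ λ u → χ u ≡ t × IsBMinus T χ u
      b⁻ t = high t , χ-high t , λ j j≢t → low j , low→high (λ j≡t → j≢t (trans j≡t (sym (χ-high t)))) , χ-low j

  half-the-components : ∃ λ N → AdmitsAcyclicBColoring T N × suc k ≤ 2 * N
  half-the-components with i₀ , largest ← argmax a | suc h ≤? a i₀
  ... | yes 1+h≤a = a i₀ , Largest.admits i₀ largest , ≤-trans 1+k≤2[1+h] (*-monoʳ-≤ 2 1+h≤a)
  ... | no 1+h≰a = suc h , Folded.admits (λ i → ≤-trans (largest i) (<⇒≤ (≰⇒> 1+h≰a))) , 1+k≤2[1+h]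

corollary12 : (n : ℕ) (T : Digraph n) → IsTournament T →
    (k : ℕ) → HasExactlySCCs T k →
    (d : ℕ) → IsDib T d → k ≤ 2 * d
corollary12 n T tournament zero _ d _ = z≤n
corollary12 n T tournament (suc k) sccs d (_ , maximal)
  with N , admits , k≤2N ← half-the-components tournament sccs
  = ≤-trans k≤2N (*-monoʳ-≤ 2 (maximal N admits))
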